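{- Let $\lambda\ge\mu$ be partitions of $n$ (dominance order), let $t=\lambda_1$, and for $i=1,\dots,t$ put $d_i^a=\sum_{j=i}^t(\widehat\lambda_j-\widehat\mu_j)$ and $d_i^b=d_{i+1}^a$ (with $d_{t+1}^a=0$). Then \[ \sum_{i=1}^t\max\{d_i^a,d_i^b\}\le c(\lambda,\mu)+q(\lambda,\mu). \]
   Context: $\widehat\lambda$ is the dual partition (column lengths, $\widehat\mu_j=0$ for $j>\mu_1$). Dominance: $\mu\le\lambda$ iff $\sum_{i\le j}\lambda_i\ge\sum_{i\le j}\mu_i$ for all $j$. $q(\lambda,\mu)=\frac12\sum_i|\lambda_i-\mu_i|$ and $c(\lambda,\mu)=\sum_i\binom{\lambda_i+1}2-\sum_i\binom{\mu_i+1}2$. -}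

module Defs where

open import Data.Nat using (ℕ; zero; suc; _+_; _*_; _∸_; _≤_; _≥_; _<_; _≤ᵇ_; _/_)
open import Data.Bool using (if_then_else_)
open import Data.List using (List; []; _∷_; map; length; foldr)
open import Data.Nat.ListAction using (sum)
open import Data.List.Relation.Unary.All using (All)
open import Data.List.Relation.Unary.Linked using (Linked)
open import Data.Integer using (ℤ; +_; _-_)
open import Data.Product using (_×_)
open import Relation.Binary.PropositionalEquality using (_≡_)

IsPartition : ℕ → List ℕ → Set
IsPartition n ps = All (λ x → 1 ≤ x) ps × Linked _≥_ ps × sum ps ≡ n

-- i-th part, 1-indexed, with value 0 beyond the length (and at index 0).
part : List ℕ → ℕ → ℕ
part []       _             = 0
part (x ∷ xs) zero          = 0
part (x ∷ xs) (suc zero)    = x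
part (x ∷ xs) (suc (suc i)) = part xs (suc i)

first : List ℕ → ℕ
first ps = part ps 1

dual : List ℕ → ℕ → ℕ
dual ps j = foldr (λ x acc → (if j ≤ᵇ x then 1 else 0) + acc) 0 ps

psum : (ℕ → ℕ) → ℕ → ℕ
psum f zero    = 0
psum f (suc j) = psum f j + f (suc j)

psumℤ : (ℕ → ℤ) → ℕ → ℤ
psumℤ f zero    = + 0
psumℤ f (suc j) = psumℤ f j Data.Integer.+ f (suc j)

Dominates : List ℕ → List ℕ → Set
Dominates lam mu = ∀ j → psum (part mu) j ≤ psum (part lam) j

-- number of indices to consider (enough to cover both partitions)
len2 : List ℕ → List ℕ → ℕ
len2 lam mu = length lam + length mu

absDiff : ℕ → ℕ → ℕ
absDiff a b = (a ∸ b) + (b ∸ a)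

-- q(λ,μ) = ½ Σ_i |λ_i − μ_i|  (the sum is even for partitions of the same n)
q : List ℕ → List ℕ → ℕ
q lam mu = psum (λ i → absDiff (part lam i) (part mu i)) (len2 lam mu) / 2

tri : ℕ → ℕ
tri k = ((k + 1) * k) / 2

c : List ℕ → List ℕ → ℤ
c lam mu = (+ sum (map tri lam)) - (+ sum (map tri mu))

-- d_i^a = Σ_{j=i}^{t} (λ̂_j − μ̂_j), as an integer, where t = λ₁
-- (written as Σ_{k=1}^{t+1-i} of the summand at j = i + k − 1; empty if i > t)
da : List ℕ → List ℕ → ℕ → ℤ
da lam mu i = psumℤ (λ k → (+ dual lam (i + k ∸ 1)) - (+ dual mu (i + k ∸ 1)))
                    (suc (first lam) ∸ i)

lhs : List ℕ → List ℕ → ℤ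
lhs lam mu = psumℤ (λ i → da lam mu i Data.Integer.⊔ da lam mu (suc i)) (first lam)

-- Write Aᵢ = Σ_{i≤j≤t} λ̂ⱼ and Bᵢ = Σ_{i≤j≤t} μ̂ⱼ, so that dᵢᵃ = Aᵢ − Bᵢ and dᵢᵃ − dᵢᵇ = λ̂ᵢ − μ̂ᵢ;
-- hence max{dᵢᵃ, dᵢᵇ} ≤ dᵢᵃ + (μ̂ᵢ ∸ λ̂ᵢ). Summation by parts gives Σᵢ Aᵢ = Σⱼ j λ̂ⱼ = Σₖ C(λₖ+1, 2),
-- and likewise for μ because dominance gives μ₁ ≤ λ₁ = t; so Σᵢ dᵢᵃ = c(λ,μ). Finally, counting
-- cells row by row, Σⱼ (μ̂ⱼ ∸ λ̂ⱼ) ≤ Σₖ (μₖ ∸ λₖ), which is q(λ,μ) since |λ| = |μ|.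

module Submission where

open import Defs
open import Data.Nat using (ℕ)
open import Data.List using (List)

module Columns where

  open import Data.Nat
  open import Data.Nat.Properties
  open import Data.Nat.DivMod using (m*n/n≡m; +-distrib-/-∣ʳ)
  open import Data.Nat.Divisibility using (divides)
  open import Data.Nat.ListAction using (sum)
  open import Data.Nat.Tactic.RingSolver using (solve-∀)
  open import Algebra.Properties.CommutativeSemigroup +-commutativeSemigroup using (interchange)
  open import Data.Bool using (true; false; if_then_else_; T)
  open import Data.List using ([]; _∷_; length; map; drop)
  open import Data.List.Properties using (length-drop)
  open import Data.List.Relation.Unary.All using (All; []; _∷_)
  open import Data.List.Relation.Unary.Linked using (Linked)
  open import Data.List.Relation.Unary.Linked.Properties using (Linked⇒All)
  open import Data.Sum using (inj₁; inj₂)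
  open import Data.Unit using (tt)
  open import Data.Empty using (⊥-elim)
  open import Relation.Nullary using (Dec; yes; no)
  open import Relation.Binary.PropositionalEquality
    using (_≡_; refl; sym; trans; cong; cong₂; subst; module ≡-Reasoning)

  psum-cong : ∀ {f g : ℕ → ℕ} m → (∀ i → i < m → f (suc i) ≡ g (suc i)) → psum f m ≡ psum g m
  psum-cong zero    _   = refl
  psum-cong (suc m) f≗g = cong₂ _+_ (psum-cong m (λ i i<m → f≗g i (m<n⇒m<1+n i<m))) (f≗g m (n<1+n m))

  psum-mono-≤ : ∀ {f g : ℕ → ℕ} m → (∀ i → i < m → f (suc i) ≤ g (suc i)) → psum f m ≤ psum g m
  psum-mono-≤ zero    _   = z≤n
  psum-mono-≤ (suc m) f≤g = +-mono-≤ (psum-mono-≤ m (λ i i<m → f≤g i (m<n⇒m<1+n i<m))) (f≤g m (n<1+n m))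

  psum-+ : ∀ (f g : ℕ → ℕ) m → psum (λ i → f i + g i) m ≡ psum f m + psum g m
  psum-+ f g zero    = refl
  psum-+ f g (suc m) = trans (cong (_+ (f (suc m) + g (suc m))) (psum-+ f g m))
                             (interchange (psum f m) (psum g m) (f (suc m)) (g (suc m)))

  psum-const : ∀ c m → psum (λ _ → c) m ≡ m * c
  psum-const c zero    = refl
  psum-const c (suc m) = trans (cong (_+ c) (psum-const c m)) (+-comm (m * c) c)

  psum-sucˡ : ∀ (f : ℕ → ℕ) m → psum f (suc m) ≡ f 1 + psum (λ k → f (suc k)) m
  psum-sucˡ f zero    = +-comm 0 (f 1)
  psum-sucˡ f (suc m) = trans (cong (_+ f (suc (suc m))) (psum-sucˡ f m)) (+-assoc (f 1) _ _)

  m+[n∸m]≡n+[m∸n] : ∀ m n → m + (n ∸ m) ≡ n + (m ∸ n)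
  m+[n∸m]≡n+[m∸n] m n with ≤-total m n
  ... | inj₁ m≤n = trans (m+[n∸m]≡n m≤n) (sym (trans (cong (n +_) (m≤n⇒m∸n≡0 m≤n)) (+-identityʳ n)))
  ... | inj₂ n≤m = trans (trans (cong (m +_) (m≤n⇒m∸n≡0 n≤m)) (+-identityʳ m)) (sym (m+[n∸m]≡n n≤m))

  psum-∸-balance : ∀ (f g : ℕ → ℕ) m → psum f m ≡ psum g m →
                   psum (λ i → f i ∸ g i) m ≡ psum (λ i → g i ∸ f i) m
  psum-∸-balance f g m Σf≡Σg = +-cancelˡ-≡ (psum f m) _ _ (begin
    psum f m + psum (λ i → f i ∸ g i) m  ≡⟨ cong (_+ psum (λ i → f i ∸ g i) m) Σf≡Σg ⟩
    psum g m + psum (λ i → f i ∸ g i) m  ≡⟨ psum-+ g (λ i → f i ∸ g i) m ⟨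
    psum (λ i → g i + (f i ∸ g i)) m     ≡⟨ psum-cong m (λ i _ → m+[n∸m]≡n+[m∸n] (g (suc i)) (f (suc i))) ⟩
    psum (λ i → f i + (g i ∸ f i)) m     ≡⟨ psum-+ f (λ i → g i ∸ f i) m ⟩
    psum f m + psum (λ i → g i ∸ f i) m  ∎)
    where open ≡-Reasoning

  psum-part : ∀ ps m → length ps ≤ m → psum (part ps) m ≡ sum ps
  psum-part []       m       _           = trans (psum-const 0 m) (*-zeroʳ m)
  psum-part (x ∷ xs) (suc m) (s≤s |xs|≤m) = trans (psum-sucˡ (part (x ∷ xs)) m)
    (cong (x +_) (trans (psum-cong m (λ _ _ → refl)) (psum-part xs m |xs|≤m)))

  -- Equal sizes make the positive and negative parts of λ − μ equal, so the halving in q is exact.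
  q≡psum-part∸part : ∀ lam mu → sum lam ≡ sum mu →
                     q lam mu ≡ psum (λ i → part mu i ∸ part lam i) (len2 lam mu)
  q≡psum-part∸part lam mu Σλ≡Σμ = begin
    psum (λ i → absDiff (part lam i) (part mu i)) L / 2  ≡⟨ cong (_/ 2) (psum-+ (λ i → part lam i ∸ part mu i) Y⁺ L) ⟩
    (psum (λ i → part lam i ∸ part mu i) L + Y) / 2      ≡⟨ cong (λ X → (X + Y) / 2) balance ⟩
    (Y + Y) / 2                                          ≡⟨ cong (λ y → (Y + y) / 2) (+-identityʳ Y) ⟨
    2 * Y / 2                                            ≡⟨ cong (_/ 2) (*-comm 2 Y) ⟩
    Y * 2 / 2                                            ≡⟨ m*n/n≡m Y 2 ⟩
    Y                                                    ∎
    where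
    open ≡-Reasoning
    L = len2 lam mu
    Y⁺ : ℕ → ℕ
    Y⁺ i = part mu i ∸ part lam i
    Y = psum Y⁺ L
    balance : psum (λ i → part lam i ∸ part mu i) L ≡ Y
    balance = psum-∸-balance (part lam) (part mu) L (begin
      psum (part lam) L ≡⟨ psum-part lam L (m≤m+n _ _) ⟩
      sum lam           ≡⟨ Σλ≡Σμ ⟩
      sum mu            ≡⟨ psum-part mu L (m≤n+m _ _) ⟨
      psum (part mu) L  ∎)

  [_≤_] : ℕ → ℕ → ℕ
  [ j ≤ x ] = if j ≤ᵇ x then 1 else 0

  [≤]-yes : ∀ {j x} → j ≤ x → [ j ≤ x ] ≡ 1
  [≤]-yes {j} {x} j≤x with j ≤ᵇ x in eq
  ... | true  = refl
  ... | false = ⊥-elim (subst T eq (≤⇒≤ᵇ j≤x))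

  [≤]-no : ∀ {j x} → x < j → [ j ≤ x ] ≡ 0
  [≤]-no {j} {x} x<j with j ≤ᵇ x in eq
  ... | false = refl
  ... | true  = ⊥-elim (<⇒≱ x<j (≤ᵇ⇒≤ j x (subst T (sym eq) tt)))

  [≤]≤1 : ∀ j x → [ j ≤ x ] ≤ 1
  [≤]≤1 j x with j ≤ᵇ x
  ... | true  = ≤-refl
  ... | false = z≤n

  psum-[≤]∸[≤] : ∀ x y t → psum (λ j → [ j ≤ y ] ∸ [ j ≤ x ]) t ≤ t ⊓ y ∸ x
  psum-[≤]∸[≤] x y zero    = z≤n
  psum-[≤]∸[≤] x y (suc t) = cell (suc t ≤? x) (suc t ≤? y)
    where
    F : ℕ → ℕ
    F j = [ j ≤ y ] ∸ [ j ≤ x ]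
    open ≤-Reasoning
    no-cell : F (suc t) ≡ 0 → psum F (suc t) ≤ suc t ⊓ y ∸ x
    no-cell F≡0 = begin
      psum F t + F (suc t)  ≡⟨ trans (cong (psum F t +_) F≡0) (+-identityʳ _) ⟩
      psum F t              ≤⟨ psum-[≤]∸[≤] x y t ⟩
      t ⊓ y ∸ x             ≤⟨ ∸-monoˡ-≤ x (⊓-monoˡ-≤ y (n≤1+n t)) ⟩
      suc t ⊓ y ∸ x         ∎
    cell : Dec (suc t ≤ x) → Dec (suc t ≤ y) → psum F (suc t) ≤ suc t ⊓ y ∸ x
    cell (yes t<x) _         = no-cell (trans (cong ([ suc t ≤ y ] ∸_) ([≤]-yes t<x)) (m≤n⇒m∸n≡0 ([≤]≤1 (suc t) y)))
    cell (no  t≮x) (no  t≮y) = no-cell (trans (cong (_∸ [ suc t ≤ x ]) ([≤]-no (≰⇒> t≮y))) (0∸n≡0 [ suc t ≤ x ]))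
    cell (no  t≮x) (yes t<y) = begin
      psum F t + F (suc t)  ≡⟨ cong₂ (λ a b → psum F t + (a ∸ b)) ([≤]-yes t<y) ([≤]-no (≰⇒> t≮x)) ⟩
      psum F t + 1          ≤⟨ +-monoˡ-≤ 1 (psum-[≤]∸[≤] x y t) ⟩
      t ⊓ y ∸ x + 1         ≡⟨ cong (λ z → z ∸ x + 1) (m≤n⇒m⊓n≡m (<⇒≤ t<y)) ⟩
      t ∸ x + 1             ≡⟨ +-comm (t ∸ x) 1 ⟩
      suc (t ∸ x)           ≡⟨ +-∸-assoc 1 (≤-pred (≰⇒> t≮x)) ⟨
      suc t ∸ x             ≡⟨ cong (_∸ x) (m≤n⇒m⊓n≡m t<y) ⟨
      suc t ⊓ y ∸ x         ∎

  [m+n]∸[o+p]≤[m∸o]+[n∸p] : ∀ m n o p → (m + n) ∸ (o + p) ≤ (m ∸ o) + (n ∸ p)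
  [m+n]∸[o+p]≤[m∸o]+[n∸p] m n o p = m≤n+o⇒m∸n≤o (m + n) (o + p) (begin
    m + n                          ≤⟨ +-mono-≤ (m≤n+m∸n m o) (m≤n+m∸n n p) ⟩
    (o + (m ∸ o)) + (p + (n ∸ p))  ≡⟨ interchange o (m ∸ o) p (n ∸ p) ⟩
    (o + p) + ((m ∸ o) + (n ∸ p))  ∎)
    where open ≤-Reasoning

  part-drop : ∀ ps i → part ps (suc (suc i)) ≡ part (drop 1 ps) (suc i)
  part-drop []       i = refl
  part-drop (x ∷ ps) i = refl

  dual-drop : ∀ ps j → dual ps (suc j) ≡ [ suc j ≤ first ps ] + dual (drop 1 ps) (suc j)
  dual-drop []       j = refl
  dual-drop (x ∷ ps) j = refl

  length-drop1≤ : ∀ (ps : List ℕ) {m} → length ps ≤ suc m → length (drop 1 ps) ≤ m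
  length-drop1≤ ps |ps|≤1+m = ≤-trans (≤-reflexive (length-drop 1 ps)) (∸-monoˡ-≤ 1 |ps|≤1+m)

  -- Each cell in column j of μ but not of λ lies in a row i with μᵢ > λᵢ, and row i
  -- contributes at most μᵢ − λᵢ such cells.
  psum-dual∸dual≤psum-part∸part : ∀ m lam mu t → length lam ≤ m → length mu ≤ m →
    psum (λ j → dual mu j ∸ dual lam j) t ≤ psum (λ i → part mu i ∸ part lam i) m
  psum-dual∸dual≤psum-part∸part zero [] [] t _ _ = ≤-reflexive (trans (psum-const 0 t) (*-zeroʳ t))
  psum-dual∸dual≤psum-part∸part (suc m) lam mu t |λ|≤m |μ|≤m = begin
    psum (λ j → dual mu j ∸ dual lam j) t
      ≤⟨ psum-mono-≤ t (λ j _ → split-first-row j) ⟩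
    psum (λ j → ([ j ≤ first mu ] ∸ [ j ≤ first lam ]) + (dual mu′ j ∸ dual lam′ j)) t
      ≡⟨ psum-+ (λ j → [ j ≤ first mu ] ∸ [ j ≤ first lam ]) (λ j → dual mu′ j ∸ dual lam′ j) t ⟩
    psum (λ j → [ j ≤ first mu ] ∸ [ j ≤ first lam ]) t + psum (λ j → dual mu′ j ∸ dual lam′ j) t
      ≤⟨ +-mono-≤ (≤-trans (psum-[≤]∸[≤] (first lam) (first mu) t) (∸-monoˡ-≤ (first lam) (m⊓n≤n t (first mu))))
                  (psum-dual∸dual≤psum-part∸part m lam′ mu′ t (length-drop1≤ lam |λ|≤m) (length-drop1≤ mu |μ|≤m)) ⟩
    (first mu ∸ first lam) + psum (λ i → part mu′ i ∸ part lam′ i) m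
      ≡⟨ cong ((first mu ∸ first lam) +_) (psum-cong m (λ i _ → cong₂ _∸_ (part-drop mu i) (part-drop lam i))) ⟨
    (first mu ∸ first lam) + psum (λ i → part mu (suc i) ∸ part lam (suc i)) m
      ≡⟨ psum-sucˡ (λ i → part mu i ∸ part lam i) m ⟨
    psum (λ i → part mu i ∸ part lam i) (suc m) ∎
    where
    open ≤-Reasoning
    lam′ = drop 1 lam
    mu′  = drop 1 mu
    split-first-row : ∀ j → dual mu (suc j) ∸ dual lam (suc j)
                          ≤ ([ suc j ≤ first mu ] ∸ [ suc j ≤ first lam ]) + (dual mu′ (suc j) ∸ dual lam′ (suc j))
    split-first-row j = ≤-trans (≤-reflexive (cong₂ _∸_ (dual-drop mu j) (dual-drop lam j)))
      ([m+n]∸[o+p]≤[m∸o]+[n∸p] [ suc j ≤ first mu ] (dual mu′ (suc j)) [ suc j ≤ first lam ] (dual lam′ (suc j)))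

  psum-dual∸dual≤q : ∀ lam mu t → sum lam ≡ sum mu → psum (λ j → dual mu j ∸ dual lam j) t ≤ q lam mu
  psum-dual∸dual≤q lam mu t Σλ≡Σμ = ≤-trans
    (psum-dual∸dual≤psum-part∸part (len2 lam mu) lam mu t
      (m≤m+n (length lam) (length mu)) (m≤n+m (length mu) (length lam)))
    (≤-reflexive (sym (q≡psum-part∸part lam mu Σλ≡Σμ)))

  parts≤first : ∀ {ps} → Linked _≥_ ps → All (_≤ first ps) ps
  parts≤first {[]}    _      = []
  parts≤first {x ∷ _} sorted = Linked⇒All (λ y≤x z≤y → ≤-trans z≤y y≤x) ≤-refl sorted

  tri-suc : ∀ k → tri (suc k) ≡ tri k + suc k
  tri-suc k = begin
    (suc k + 1) * suc k / 2        ≡⟨ cong (_/ 2) (expand k) ⟩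
    ((k + 1) * k + suc k * 2) / 2  ≡⟨ +-distrib-/-∣ʳ ((k + 1) * k) (divides (suc k) refl) ⟩
    tri k + suc k * 2 / 2          ≡⟨ cong (tri k +_) (m*n/n≡m (suc k) 2) ⟩
    tri k + suc k                  ∎
    where
    open ≡-Reasoning
    expand : ∀ k → (suc k + 1) * suc k ≡ (k + 1) * k + suc k * 2
    expand = solve-∀

  psum-j*[≤] : ∀ x t → psum (λ j → j * [ j ≤ x ]) t ≡ tri (t ⊓ x)
  psum-j*[≤] x zero    = refl
  psum-j*[≤] x (suc t) with suc t ≤? x
  ... | yes t<x = begin
    psum (λ j → j * [ j ≤ x ]) t + suc t * [ suc t ≤ x ]
      ≡⟨ cong₂ _+_ (psum-j*[≤] x t) (cong (suc t *_) ([≤]-yes t<x)) ⟩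
    tri (t ⊓ x) + suc t * 1  ≡⟨ cong₂ _+_ (cong tri (m≤n⇒m⊓n≡m (<⇒≤ t<x))) (*-identityʳ (suc t)) ⟩
    tri t + suc t            ≡⟨ tri-suc t ⟨
    tri (suc t)              ≡⟨ cong tri (m≤n⇒m⊓n≡m t<x) ⟨
    tri (suc t ⊓ x)          ∎
    where open ≡-Reasoning
  ... | no t≮x = begin
    psum (λ j → j * [ j ≤ x ]) t + suc t * [ suc t ≤ x ]
      ≡⟨ cong₂ _+_ (psum-j*[≤] x t) (cong (suc t *_) ([≤]-no (≰⇒> t≮x))) ⟩
    tri (t ⊓ x) + suc t * 0  ≡⟨ cong₂ _+_ (cong tri (m≥n⇒m⊓n≡n (≤-pred (≰⇒> t≮x)))) (*-zeroʳ (suc t)) ⟩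
    tri x + 0                ≡⟨ +-identityʳ (tri x) ⟩
    tri x                    ≡⟨ cong tri (m≥n⇒m⊓n≡n (<⇒≤ (≰⇒> t≮x))) ⟨
    tri (suc t ⊓ x)          ∎
    where open ≡-Reasoning

  psum-j*dual : ∀ ps t → All (_≤ t) ps → psum (λ j → j * dual ps j) t ≡ sum (map tri ps)
  psum-j*dual []       t []            =
    trans (psum-cong t (λ i _ → *-zeroʳ (suc i))) (trans (psum-const 0 t) (*-zeroʳ t))
  psum-j*dual (x ∷ xs) t (x≤t ∷ xs≤t) = begin
    psum (λ j → j * ([ j ≤ x ] + dual xs j)) t
      ≡⟨ psum-cong t (λ i _ → *-distribˡ-+ (suc i) [ suc i ≤ x ] (dual xs (suc i))) ⟩
    psum (λ j → j * [ j ≤ x ] + j * dual xs j) t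
      ≡⟨ psum-+ (λ j → j * [ j ≤ x ]) (λ j → j * dual xs j) t ⟩
    psum (λ j → j * [ j ≤ x ]) t + psum (λ j → j * dual xs j) t
      ≡⟨ cong₂ _+_ (trans (psum-j*[≤] x t) (cong tri (m≥n⇒m⊓n≡n x≤t))) (psum-j*dual xs t xs≤t) ⟩
    tri x + sum (map tri xs) ∎
    where open ≡-Reasoning

  -- segSum g i t = g i + g (i + 1) + … + g t
  segSum : (ℕ → ℕ) → ℕ → ℕ → ℕ
  segSum g i t = psum (λ k → g (i + k ∸ 1)) (suc t ∸ i)

  segSum-empty : ∀ g t → segSum g (suc t) t ≡ 0
  segSum-empty g t = cong (psum (λ k → g (suc t + k ∸ 1))) (n∸n≡0 t)

  segSum-head : ∀ g {i t} → i ≤ t → segSum g i t ≡ g i + segSum g (suc i) t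
  segSum-head g {i} {t} i≤t = begin
    psum f (suc t ∸ i)                     ≡⟨ cong (psum f) (+-∸-assoc 1 i≤t) ⟩
    psum f (suc (t ∸ i))                   ≡⟨ psum-sucˡ f (t ∸ i) ⟩
    f 1 + psum (λ k → f (suc k)) (t ∸ i)
      ≡⟨ cong₂ _+_ (cong g (m+n∸n≡m i 1)) (psum-cong (t ∸ i) (λ k _ → cong (λ z → g (z ∸ 1)) (+-suc i (suc k)))) ⟩
    g i + segSum g (suc i) t               ∎
    where
    open ≡-Reasoning
    f : ℕ → ℕ
    f k = g (i + k ∸ 1)

  segSum-last : ∀ g {i t} → i ≤ suc t → segSum g i (suc t) ≡ segSum g i t + g (suc t)
  segSum-last g {i} {t} i≤1+t = begin
    psum f (suc (suc t) ∸ i)         ≡⟨ cong (psum f) (+-∸-assoc 1 i≤1+t) ⟩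
    psum f (suc t ∸ i) + f (suc (suc t ∸ i))
      ≡⟨ cong (λ z → psum f (suc t ∸ i) + g z) (trans (cong (_∸ 1) (+-suc i (suc t ∸ i))) (m+[n∸m]≡n i≤1+t)) ⟩
    psum f (suc t ∸ i) + g (suc t)   ∎
    where
    open ≡-Reasoning
    f : ℕ → ℕ
    f k = g (i + k ∸ 1)

  -- Summation by parts: g j is counted once for each i ≤ j.
  psum-segSum : ∀ g t → psum (λ i → segSum g i t) t ≡ psum (λ j → j * g j) t
  psum-segSum g zero    = refl
  psum-segSum g (suc t) = begin
    psum (λ i → segSum g i (suc t)) t + segSum g (suc t) (suc t)
      ≡⟨ cong₂ _+_ (psum-cong t (λ i i<t → segSum-last g (s≤s (<⇒≤ i<t))))
                   (trans (segSum-last g ≤-refl) (cong (_+ g (suc t)) (segSum-empty g t))) ⟩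
    psum (λ i → segSum g i t + g (suc t)) t + g (suc t)
      ≡⟨ cong (_+ g (suc t)) (psum-+ (λ i → segSum g i t) (λ _ → g (suc t)) t) ⟩
    psum (λ i → segSum g i t) t + psum (λ _ → g (suc t)) t + g (suc t)
      ≡⟨ cong₂ (λ a b → a + b + g (suc t)) (psum-segSum g t) (psum-const (g (suc t)) t) ⟩
    psum (λ j → j * g j) t + t * g (suc t) + g (suc t)
      ≡⟨ trans (+-assoc _ (t * g (suc t)) (g (suc t)))
               (cong (psum (λ j → j * g j) t +_) (+-comm (t * g (suc t)) (g (suc t)))) ⟩
    psum (λ j → j * g j) t + suc t * g (suc t) ∎
    where open ≡-Reasoning

open Columns

open import Data.Integer using (_≤_; _+_; +_)
open import Data.Integer using (ℤ; -_; _-_; _⊔_; +≤+)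
open import Data.Integer.Properties
  using (≤-refl; +-mono-≤; +-monoˡ-≤; ⊔-lub; pos-+; module ≤-Reasoning)
open import Data.Integer.Tactic.RingSolver using (solve-∀)
import Data.Nat as ℕ
import Data.Nat.Properties as ℕ
import Data.Nat.Tactic.RingSolver as ℕ
open import Data.Nat.ListAction using (sum)
open import Data.List using (map)
open import Data.List.Relation.Unary.All as All using (All)
open import Data.Product using (_,_)
open import Relation.Binary.PropositionalEquality
  using (_≡_; refl; sym; trans; cong; cong₂; subst₂; module ≡-Reasoning)

psumℤ-mono-≤ : ∀ {f g : ℕ → ℤ} m → (∀ i → i ℕ.< m → f (ℕ.suc i) ≤ g (ℕ.suc i)) → psumℤ f m ≤ psumℤ g m
psumℤ-mono-≤ ℕ.zero    _   = ≤-refl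
psumℤ-mono-≤ (ℕ.suc m) f≤g = +-mono-≤ (psumℤ-mono-≤ m (λ i i<m → f≤g i (ℕ.m<n⇒m<1+n i<m))) (f≤g m (ℕ.n<1+n m))

psumℤ-difference : ∀ (f g : ℕ → ℕ) m → psumℤ (λ k → + f k - + g k) m ≡ + psum f m - + psum g m
psumℤ-difference f g ℕ.zero    = refl
psumℤ-difference f g (ℕ.suc m) = begin
  psumℤ (λ k → + f k - + g k) m + (+ f (ℕ.suc m) - + g (ℕ.suc m))
    ≡⟨ cong (_+ (+ f (ℕ.suc m) - + g (ℕ.suc m))) (psumℤ-difference f g m) ⟩
  (+ psum f m - + psum g m) + (+ f (ℕ.suc m) - + g (ℕ.suc m))
    ≡⟨ interchange-minus (+ psum f m) (+ psum g m) (+ f (ℕ.suc m)) (+ g (ℕ.suc m)) ⟩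
  (+ psum f m + + f (ℕ.suc m)) - (+ psum g m + + g (ℕ.suc m))
    ≡⟨ cong₂ _-_ (pos-+ (psum f m) (f (ℕ.suc m))) (pos-+ (psum g m) (g (ℕ.suc m))) ⟨
  + psum f (ℕ.suc m) - + psum g (ℕ.suc m) ∎
  where
  open ≡-Reasoning
  interchange-minus : ∀ a b c d → (a - b) + (c - d) ≡ (a + c) - (b + d)
  interchange-minus = solve-∀

+m-+n≤+o-+p : ∀ m n o p → m ℕ.+ p ℕ.≤ o ℕ.+ n → + m - + n ≤ + o - + p
+m-+n≤+o-+p m n o p m+p≤o+n = begin
  + m - + n                    ≡⟨ shift (+ m) (+ n) (+ p) ⟩
  (+ m + + p) - (+ n + + p)    ≤⟨ +-monoˡ-≤ (- (+ n + + p)) (subst₂ _≤_ (pos-+ m p) (pos-+ o n) (+≤+ m+p≤o+n)) ⟩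
  (+ o + + n) - (+ n + + p)    ≡⟨ cancel (+ o) (+ n) (+ p) ⟩
  + o - + p                    ∎
  where
  open ≤-Reasoning
  shift : ∀ a b c → a - b ≡ (a + c) - (b + c)
  shift = solve-∀
  cancel : ∀ a b c → (a + b) - (b + c) ≡ a - c
  cancel = solve-∀

-- With dᵢ = (l − u) + dᵢ₊₁, the larger of dᵢ and dᵢ₊₁ exceeds dᵢ by at most u ∸ l.
⊔-step≤ : ∀ l A u B → (+ (l ℕ.+ A) - + (u ℕ.+ B)) ⊔ (+ A - + B) ≤ + (l ℕ.+ A ℕ.+ (u ℕ.∸ l)) - + (u ℕ.+ B)
⊔-step≤ l A u B = ⊔-lub
  (+-monoˡ-≤ (- + (u ℕ.+ B)) (+≤+ (ℕ.m≤m+n (l ℕ.+ A) (u ℕ.∸ l))))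
  (+m-+n≤+o-+p A B (l ℕ.+ A ℕ.+ (u ℕ.∸ l)) (u ℕ.+ B) (begin
    A ℕ.+ (u ℕ.+ B)                 ≤⟨ ℕ.+-monoʳ-≤ A (ℕ.+-monoˡ-≤ B (ℕ.m≤n+m∸n u l)) ⟩
    A ℕ.+ ((l ℕ.+ (u ℕ.∸ l)) ℕ.+ B)  ≡⟨ rearrange A l (u ℕ.∸ l) B ⟩
    (l ℕ.+ A ℕ.+ (u ℕ.∸ l)) ℕ.+ B    ∎))
  where
  open ℕ.≤-Reasoning
  rearrange : ∀ a b c d → a ℕ.+ ((b ℕ.+ c) ℕ.+ d) ≡ (b ℕ.+ a ℕ.+ c) ℕ.+ d
  rearrange = ℕ.solve-∀

-- Σ_{j=i}^{t} (g j − h j), encoded as in Defs.da: for g, h = dual λ, dual μ and t = λ₁ it is dᵢᵃ.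
segDiff : (ℕ → ℕ) → (ℕ → ℕ) → ℕ → ℕ → ℤ
segDiff g h t i = psumℤ (λ k → + g (i ℕ.+ k ℕ.∸ 1) - + h (i ℕ.+ k ℕ.∸ 1)) (ℕ.suc t ℕ.∸ i)

segDiff≡segSum-segSum : ∀ g h t i → segDiff g h t i ≡ + segSum g i t - + segSum h i t
segDiff≡segSum-segSum g h t i =
  psumℤ-difference (λ k → g (i ℕ.+ k ℕ.∸ 1)) (λ k → h (i ℕ.+ k ℕ.∸ 1)) (ℕ.suc t ℕ.∸ i)

psumℤ-segDiff-⊔≤ : ∀ g h t →
  psumℤ (λ i → segDiff g h t i ⊔ segDiff g h t (ℕ.suc i)) t
    ≤ + (psum (λ j → j ℕ.* g j) t ℕ.+ psum (λ j → h j ℕ.∸ g j) t) - + psum (λ j → j ℕ.* h j) t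
psumℤ-segDiff-⊔≤ g h t = begin
  psumℤ (λ i → segDiff g h t i ⊔ segDiff g h t (ℕ.suc i)) t
    ≤⟨ psumℤ-mono-≤ t step ⟩
  psumℤ (λ i → + (segSum g i t ℕ.+ (h i ℕ.∸ g i)) - + segSum h i t) t
    ≡⟨ psumℤ-difference (λ i → segSum g i t ℕ.+ (h i ℕ.∸ g i)) (λ i → segSum h i t) t ⟩
  + psum (λ i → segSum g i t ℕ.+ (h i ℕ.∸ g i)) t - + psum (λ i → segSum h i t) t
    ≡⟨ cong₂ (λ a b → + a - + b)
         (trans (psum-+ (λ i → segSum g i t) (λ i → h i ℕ.∸ g i) t)
                (cong (ℕ._+ psum (λ j → h j ℕ.∸ g j) t) (psum-segSum g t)))
         (psum-segSum h t) ⟩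
  + (psum (λ j → j ℕ.* g j) t ℕ.+ psum (λ j → h j ℕ.∸ g j) t) - + psum (λ j → j ℕ.* h j) t ∎
  where
  open ≤-Reasoning
  step : ∀ i → i ℕ.< t → segDiff g h t (ℕ.suc i) ⊔ segDiff g h t (ℕ.suc (ℕ.suc i))
                          ≤ + (segSum g (ℕ.suc i) t ℕ.+ (h (ℕ.suc i) ℕ.∸ g (ℕ.suc i))) - + segSum h (ℕ.suc i) t
  step i i<t = begin
    segDiff g h t (ℕ.suc i) ⊔ segDiff g h t (ℕ.suc (ℕ.suc i))
      ≡⟨ cong₂ _⊔_ (trans (segDiff≡segSum-segSum g h t (ℕ.suc i)) (cong₂ (λ a b → + a - + b) gᵢ hᵢ))
                   (segDiff≡segSum-segSum g h t (ℕ.suc (ℕ.suc i))) ⟩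
    (+ (g (ℕ.suc i) ℕ.+ G) - + (h (ℕ.suc i) ℕ.+ H)) ⊔ (+ G - + H)
      ≤⟨ ⊔-step≤ (g (ℕ.suc i)) G (h (ℕ.suc i)) H ⟩
    + (g (ℕ.suc i) ℕ.+ G ℕ.+ (h (ℕ.suc i) ℕ.∸ g (ℕ.suc i))) - + (h (ℕ.suc i) ℕ.+ H)
      ≡⟨ cong₂ (λ a b → + (a ℕ.+ (h (ℕ.suc i) ℕ.∸ g (ℕ.suc i))) - + b) gᵢ hᵢ ⟨
    + (segSum g (ℕ.suc i) t ℕ.+ (h (ℕ.suc i) ℕ.∸ g (ℕ.suc i))) - + segSum h (ℕ.suc i) t ∎
    where
    G = segSum g (ℕ.suc (ℕ.suc i)) t
    H = segSum h (ℕ.suc (ℕ.suc i)) t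
    gᵢ : segSum g (ℕ.suc i) t ≡ g (ℕ.suc i) ℕ.+ G
    gᵢ = segSum-head g i<t
    hᵢ : segSum h (ℕ.suc i) t ≡ h (ℕ.suc i) ℕ.+ H
    hᵢ = segSum-head h i<t

+[m+n]-+o≡+m-+o++n : ∀ m n o → + (m ℕ.+ n) - + o ≡ (+ m - + o) + + n
+[m+n]-+o≡+m-+o++n m n o = trans (cong (_- + o) (pos-+ m n)) (shuffle (+ m) (+ n) (+ o))
  where
  shuffle : ∀ a b c → (a + b) - c ≡ (a - c) + b
  shuffle = solve-∀

mainTheorem7 : (n : ℕ) (lam mu : List ℕ) →
    IsPartition n lam → IsPartition n mu → Dominates lam mu →
    lhs lam mu ≤ c lam mu + (+ q lam mu)
mainTheorem7 n lam mu (_ , λ-sorted , Σλ≡n) (_ , μ-sorted , Σμ≡n) μ⊴λ = begin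
  lhs lam mu
    ≤⟨ psumℤ-segDiff-⊔≤ (dual lam) (dual mu) t ⟩
  + (psum (λ j → j ℕ.* dual lam j) t ℕ.+ psum (λ j → dual mu j ℕ.∸ dual lam j) t) - + psum (λ j → j ℕ.* dual mu j) t
    ≡⟨ cong₂ (λ a b → + (a ℕ.+ psum (λ j → dual mu j ℕ.∸ dual lam j) t) - + b)
             (psum-j*dual lam t λ≤t) (psum-j*dual mu t μ≤t) ⟩
  + (sum (map tri lam) ℕ.+ psum (λ j → dual mu j ℕ.∸ dual lam j) t) - + sum (map tri mu)
    ≤⟨ +-monoˡ-≤ (- + sum (map tri mu))
         (+≤+ (ℕ.+-monoʳ-≤ (sum (map tri lam)) (psum-dual∸dual≤q lam mu t (trans Σλ≡n (sym Σμ≡n))))) ⟩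
  + (sum (map tri lam) ℕ.+ q lam mu) - + sum (map tri mu)
    ≡⟨ +[m+n]-+o≡+m-+o++n (sum (map tri lam)) (q lam mu) (sum (map tri mu)) ⟩
  c lam mu + + q lam mu ∎
  where
  open ≤-Reasoning
  t = first lam
  λ≤t : All (ℕ._≤ t) lam
  λ≤t = parts≤first λ-sorted
  μ≤t : All (ℕ._≤ t) mu
  μ≤t = All.map (λ x≤μ₁ → ℕ.≤-trans x≤μ₁ (μ⊴λ 1)) (parts≤first μ-sorted)
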